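{- Let $n\leq N$ be positive integers. For an embedding $f:2^{[n]}\to 2^{[N]}$ define its characteristic vector $(U_1(f),\dots,U_N(f))$ by $U_j(f)=\{S\in 2^{[n]}: j\in f(S)\}$. Then the map $f\mapsto (U_1(f),\dots,U_N(f))$ is a bijection between the set of embeddings of $2^{[n]}$ into $2^{[N]}$ and the set of good sequences of length $N$ of upper-closed subsets of $2^{[n]}$.
   Context: An embedding $f:2^{[n]}\to2^{[N]}$ is an injective map with $A\subseteq B$ iff $f(A)\subseteq f(B)$. A family $U\subseteq 2^{[n]}$ is upper closed if $S\in U$ and $S\subseteq S'\subseteq[n]$ imply $S'\in U$ (the empty family is allowed). For $i\in[n]$, $\{i\}^+=\{S\subseteq[n]: i\in S\}$. A sequence $(U_1,\dots,U_N)$ of upper-closed families in $2^{[n]}$ is good if each of $\{1\}^+,\dots,\{n\}^+$ occurs among $U_1,\dots,U_N$. -}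

module Defs where

open import Data.Nat using (ℕ)
open import Data.Bool using (Bool; true; false)
open import Data.Fin using (Fin)
open import Data.Fin.Subset using (Subset; _⊆_; _∈_)
open import Data.Vec using (lookup)
open import Data.Product using (Σ; ∃; _×_)
open import Function.Bundles using (_⇔_)
open import Function.Definitions using (Injective)
open import Relation.Binary.PropositionalEquality using (_≡_)

-- 2^[n] is  Subset n  (= Vec Bool n).
-- A family of subsets of [n] (a subset of 2^[n]) is given by its
-- membership indicator  Subset n → Bool  (2^[n] is finite, so families are decidable).
Family : ℕ → Set
Family n = Subset n → Bool

_≐_ : ∀ {n} → Family n → Family n → Set
U ≐ V = ∀ S → U S ≡ V S

IsEmbedding : ∀ {n N} → (Subset n → Subset N) → Set
IsEmbedding f = Injective _≡_ _≡_ f × (∀ A B → (A ⊆ B) ⇔ (f A ⊆ f B))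

UpperClosed : ∀ {n} → Family n → Set
UpperClosed U = ∀ S S′ → U S ≡ true → S ⊆ S′ → U S′ ≡ true

singletonUp : ∀ {n} → Fin n → Family n
singletonUp i S = lookup S i

IsGood : ∀ {n N} → (Fin N → Family n) → Set
IsGood {n} {N} U = (∀ j → UpperClosed (U j)) × (∀ (i : Fin n) → ∃ λ (j : Fin N) → U j ≐ singletonUp i)

charVec : ∀ {n N} → (Subset n → Subset N) → Fin N → Family n
charVec f j S = lookup (f S) j

module Submission where

-- The coordinates j ↦ {S : j ∈ f S} of a map f : 2^[n] → 2^[N] determine it, and they
-- are upper closed exactly when f is monotone. If {i}^+ occurs among them, f reflects
-- inclusion: the coordinate equal to {i}^+ reads off membership of i. Conversely, if f
-- reflects inclusion then f ⁅i⁆ ⊈ f (∁ ⁅i⁆), and any coordinate j in the difference is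
-- {i}^+, since by monotonicity j ∈ f S when i ∈ S and j ∉ f S when S ⊆ ∁ ⁅i⁆. So
-- embeddings are exactly the maps with good coordinate sequences, and every sequence is
-- the coordinate sequence of S ↦ {j : S ∈ U_j}.

open import Defs
open import Data.Nat using (ℕ; _≤_)
open import Data.Bool using (false)
open import Data.Bool.Properties using (¬-not)
open import Data.Fin using (Fin)
open import Data.Fin.Properties using (any?)
open import Data.Fin.Subset using (Subset; _⊆_; _⊈_; _∈_; _∉_; ⁅_⁆; ∁)
open import Data.Fin.Subset.Properties
  using (_∈?_; ⊆-reflexive; ⊆-antisym; x∈⁅x⁆; x∈⁅y⁆⇒x≡y; x∈p⇒x∉∁p; x∉p⇒x∈∁p)
open import Data.Vec using (lookup; tabulate)
open import Data.Vec.Properties using ([]=⇒lookup; lookup⇒[]=; lookup∘tabulate; tabulate∘lookup; tabulate-cong)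
open import Data.Empty using (⊥-elim)
open import Data.Product using (Σ; ∃; _×_; _,_)
open import Function.Base using (_∘_)
open import Function.Bundles using (mk⇔; module Equivalence)
open import Function.Definitions using (Injective)
open import Relation.Binary.Core using (_Preserves_⟶_)
open import Relation.Binary.PropositionalEquality using (_≡_; sym; trans; subst; module ≡-Reasoning)
open import Relation.Nullary using (yes; no; ¬?)
open import Relation.Nullary.Decidable using (_×-dec_; decidable-stable)

private
  variable
    n N : ℕ

⊈⇒∃∈∉ : {p q : Subset n} → p ⊈ q → ∃ λ x → x ∈ p × x ∉ q
⊈⇒∃∈∉ {p = p} {q} p⊈q with any? (λ x → x ∈? p ×-dec ¬? (x ∈? q))
... | yes witness = witness
... | no ∄ = ⊥-elim (p⊈q p⊆q)
  where
  p⊆q : p ⊆ q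
  p⊆q {x} x∈p = decidable-stable (x ∈? q) (λ x∉q → ∄ (x , x∈p , x∉q))

x∈p⇒⁅x⁆⊆p : {x : Fin n} {p : Subset n} → x ∈ p → ⁅ x ⁆ ⊆ p
x∈p⇒⁅x⁆⊆p {p = p} x∈p y∈⁅x⁆ = subst (_∈ p) (sym (x∈⁅y⁆⇒x≡y _ y∈⁅x⁆)) x∈p

x∉p⇒p⊆∁⁅x⁆ : {x : Fin n} {p : Subset n} → x ∉ p → p ⊆ ∁ ⁅ x ⁆
x∉p⇒p⊆∁⁅x⁆ {p = p} x∉p y∈p = x∉p⇒x∈∁p (λ y∈⁅x⁆ → x∉p (subst (_∈ p) (x∈⁅y⁆⇒x≡y _ y∈⁅x⁆) y∈p))

∉⇒lookup≡false : {x : Fin n} {p : Subset n} → x ∉ p → lookup p x ≡ false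
∉⇒lookup≡false x∉p = ¬-not (x∉p ∘ lookup⇒[]= _ _)

UpperClosed-resp-≐ : {U V : Family n} → U ≐ V → UpperClosed V → UpperClosed U
UpperClosed-resp-≐ U≐V V↑ S S′ US S⊆S′ = trans (U≐V S′) (V↑ S S′ (trans (sym (U≐V S)) US) S⊆S′)

IsGood-resp-≐ : {U V : Fin N → Family n} → (∀ j → U j ≐ V j) → IsGood V → IsGood U
IsGood-resp-≐ U≐V (V↑ , occurs) =
  (λ j → UpperClosed-resp-≐ (U≐V j) (V↑ j)) ,
  (λ i → let (j , Vj≐i⁺) = occurs i in j , λ S → trans (U≐V j S) (Vj≐i⁺ S))

module _ {f : Subset n → Subset N} where

  charVec-injective : {g : Subset n → Subset N} → (∀ j → charVec f j ≐ charVec g j) → ∀ S → f S ≡ g S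
  charVec-injective {g} f≐g S = begin
    f S                            ≡⟨ tabulate∘lookup (f S) ⟨
    tabulate (λ j → charVec f j S) ≡⟨ tabulate-cong (λ j → f≐g j S) ⟩
    tabulate (λ j → charVec g j S) ≡⟨ tabulate∘lookup (g S) ⟩
    g S                            ∎
    where open ≡-Reasoning

  monotone⇒charVec-upperClosed : f Preserves _⊆_ ⟶ _⊆_ → ∀ j → UpperClosed (charVec f j)
  monotone⇒charVec-upperClosed mono j S S′ j∈fS S⊆S′ = []=⇒lookup (mono S⊆S′ (lookup⇒[]= j (f S) j∈fS))

  charVec-upperClosed⇒monotone : (∀ j → UpperClosed (charVec f j)) → f Preserves _⊆_ ⟶ _⊆_
  charVec-upperClosed⇒monotone ↑ {A} {B} A⊆B {j} j∈fA =
    lookup⇒[]= j (f B) (↑ j A B ([]=⇒lookup j∈fA) A⊆B)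

  charVec-occurs⇒reflects-⊆ : (∀ i → ∃ λ j → charVec f j ≐ singletonUp i) → Injective _⊆_ _⊆_ f
  charVec-occurs⇒reflects-⊆ occurs {A} {B} fA⊆fB {i} i∈A =
    let (j , fj≐i⁺) = occurs i
        j∈fA = lookup⇒[]= j (f A) (trans (fj≐i⁺ A) ([]=⇒lookup i∈A))
    in lookup⇒[]= i B (trans (sym (fj≐i⁺ B)) ([]=⇒lookup (fA⊆fB j∈fA)))

  separating-coordinate : f Preserves _⊆_ ⟶ _⊆_ → {i : Fin n} {j : Fin N} →
    j ∈ f ⁅ i ⁆ → j ∉ f (∁ ⁅ i ⁆) → charVec f j ≐ singletonUp i
  separating-coordinate mono {i} {j} j∈f⁅i⁆ j∉f∁⁅i⁆ S with i ∈? S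
  ... | yes i∈S = trans ([]=⇒lookup (mono (x∈p⇒⁅x⁆⊆p i∈S) j∈f⁅i⁆)) (sym ([]=⇒lookup i∈S))
  ... | no i∉S = trans (∉⇒lookup≡false (j∉f∁⁅i⁆ ∘ mono (x∉p⇒p⊆∁⁅x⁆ i∉S))) (sym (∉⇒lookup≡false i∉S))

  isEmbedding⇒good : IsEmbedding f → IsGood (charVec f)
  isEmbedding⇒good (_ , ⊆⇔f⊆) = monotone⇒charVec-upperClosed mono , occurs
    where
    mono : f Preserves _⊆_ ⟶ _⊆_
    mono {A} {B} = Equivalence.to (⊆⇔f⊆ A B)

    occurs : ∀ i → ∃ λ j → charVec f j ≐ singletonUp i
    occurs i =
      let (j , j∈f⁅i⁆ , j∉f∁⁅i⁆) = ⊈⇒∃∈∉ f⁅i⁆⊈f∁⁅i⁆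
      in j , separating-coordinate mono j∈f⁅i⁆ j∉f∁⁅i⁆
      where
      f⁅i⁆⊈f∁⁅i⁆ : f ⁅ i ⁆ ⊈ f (∁ ⁅ i ⁆)
      f⁅i⁆⊈f∁⁅i⁆ f⊆ = x∈p⇒x∉∁p (x∈⁅x⁆ i) (Equivalence.from (⊆⇔f⊆ _ _) f⊆ (x∈⁅x⁆ i))

  good⇒isEmbedding : IsGood (charVec f) → IsEmbedding f
  good⇒isEmbedding (↑ , occurs) = injective , λ A B → mk⇔ mono reflects
    where
    mono : f Preserves _⊆_ ⟶ _⊆_
    mono = charVec-upperClosed⇒monotone ↑

    reflects : Injective _⊆_ _⊆_ f
    reflects = charVec-occurs⇒reflects-⊆ occurs

    injective : Injective _≡_ _≡_ f
    injective fA≡fB = ⊆-antisym (reflects (⊆-reflexive fA≡fB)) (reflects (⊆-reflexive (sym fA≡fB)))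

fromCharVec : (Fin N → Family n) → Subset n → Subset N
fromCharVec U S = tabulate λ j → U j S

charVec-fromCharVec : (U : Fin N → Family n) → ∀ j → charVec (fromCharVec U) j ≐ U j
charVec-fromCharVec U j S = lookup∘tabulate (λ j → U j S) j

theorem5 : (n N : ℕ) → 1 ≤ n → n ≤ N →
    ((f : Subset n → Subset N) → IsEmbedding f → IsGood (charVec f))
    × ((f g : Subset n → Subset N) → IsEmbedding f → IsEmbedding g →
        (∀ j → charVec f j ≐ charVec g j) → ∀ S → f S ≡ g S)
    × ((U : Fin N → Family n) → IsGood U →
        Σ (Subset n → Subset N) λ f → IsEmbedding f × (∀ j → charVec f j ≐ U j))
theorem5 _ _ _ _ =
  (λ _ → isEmbedding⇒good) ,
  (λ _ _ _ _ → charVec-injective) ,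
  λ U good → fromCharVec U ,
             good⇒isEmbedding (IsGood-resp-≐ (charVec-fromCharVec U) good) ,
             charVec-fromCharVec U
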